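{- Let $E$ be a big-step evaluator of the pure $\lambda$-calculus defined by the eval-apply template below with parameters $\mathit{op}_1=E$, $\mathit{op}_2=\mathrm{id}$, and each of $\mathit{la},\mathit{ar}_1,\mathit{ar}_2$ equal to either $\mathrm{id}$ or $E$ itself (the uniform provisos). Then the strategy defined by $E$ is uniform: its set of contexts $\mathsf{ST}_E$ satisfies, for all contexts $\mathcal{C}_1,\mathcal{C}_2$, $\mathcal{C}_1(\mathcal{C}_2)\in\mathsf{ST}_E$ if and only if $\mathcal{C}_1\in\mathsf{ST}_E$ and $\mathcal{C}_2\in\mathsf{ST}_E$.
   Context: Terms: $\Lambda ::= x\mid \lambda x.\Lambda\mid \Lambda\Lambda$ (modulo $\alpha$-conversion); $[N/x]B$ is capture-avoiding substitution. A context is a term with one hole $\Box$; $\mathcal{C}(R)$ fills the hole with $R$ and $\mathcal{C}_1(\mathcal{C}_2)$ fills the hole of $\mathcal{C}_1$ with $\mathcal{C}_2$. An evaluator is a partial function $\Lambda\rightharpoonup\Lambda$ (undefined = divergence); $\mathrm{id}$ is the identity. Eval-apply template: $E$ is the least partial function such that $E(x)=x$; $E(\lambda x.B)=\lambda x.\mathit{la}(B)$; for $E(MN)$: first compute $M'=\mathit{op}_1(M)$; if $M'\equiv\lambda x.B$ then compute $N'=\mathit{ar}_1(N)$, contract the redex $(\lambda x.B)N'$ to $[N'/x]B$ and return $E([N'/x]B)$; otherwise compute $M''=\mathit{op}_2(M')$, then $N'=\mathit{ar}_2(N)$, and return $M''N'$. Computations are performed in the listed order and divergence of any of them makes the whole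 diverge. The evaluation of a term $M$ thus performs a (finite or infinite) sequence of $\beta$-contractions, each at a definite position of the current reduct; the strategy defined by $E$ maps a non-final term to the reduct after the first contraction, and its set of contexts $\mathsf{ST}_E$ is the set of contexts $\mathcal{C}$ such that for some term of the form $\mathcal{C}(R)$ the next redex contracted by $E$ is the redex $R$ at the hole. -}

module Defs where

open import Data.Nat using (ℕ; zero; suc)
open import Data.List using (List; []; _∷_; _++_; map)
open import Data.Product using (Σ; _,_)
open import Relation.Binary.PropositionalEquality using (_≡_)
open import Relation.Nullary using (¬_)

-- Pure λ-terms modulo α-conversion: de Bruijn indices (var 0 is the
-- innermost binder).  Free variables are allowed (open terms).

data Term : Set where
  var : ℕ → Term
  lam : Term → Term
  app : Term → Term → Term

ext : (ℕ → ℕ) → ℕ → ℕ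
ext ρ zero    = zero
ext ρ (suc k) = suc (ρ k)

rename : (ℕ → ℕ) → Term → Term
rename ρ (var k)   = var (ρ k)
rename ρ (lam B)   = lam (rename (ext ρ) B)
rename ρ (app M N) = app (rename ρ M) (rename ρ N)

exts : (ℕ → Term) → ℕ → Term
exts σ zero    = var zero
exts σ (suc k) = rename suc (σ k)

subst : (ℕ → Term) → Term → Term
subst σ (var k)   = σ k
subst σ (lam B)   = lam (subst (exts σ) B)
subst σ (app M N) = app (subst σ M) (subst σ N)

single : Term → ℕ → Term
single N zero    = N
single N (suc k) = var k

_[_] : Term → Term → Term
B [ N ] = subst (single N) B

IsLam : Term → Set
IsLam M = Σ Term (λ B → M ≡ lam B)

data Ctx : Set where
  □    : Ctx
  lamC : Ctx → Ctx
  appL : Ctx → Term → Ctx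
  appR : Term → Ctx → Ctx

plug : Ctx → Term → Term
plug □          R = R
plug (lamC C)   R = lam (plug C R)
plug (appL C N) R = app (plug C R) N
plug (appR M C) R = app M (plug C R)

_∘C_ : Ctx → Ctx → Ctx
□        ∘C C₂ = C₂
lamC C   ∘C C₂ = lamC (C ∘C C₂)
appL C N ∘C C₂ = appL (C ∘C C₂) N
appR M C ∘C C₂ = appR M (C ∘C C₂)

-- Parameters of the eval-apply template restricted to the uniform
-- provisos: op₁ = E, op₂ = id, and la, ar₁, ar₂ ∈ {id, E}.

data Mode : Set where
  Id : Mode
  Ev : Mode

module EvalApply (la ar₁ ar₂ : Mode) where

  -- Instrumented big-step evaluator (convergent runs):
  --   Eval M cs V  :  E(M) = V, and cs is the list of the positions
  --   (contexts, relative to the current reduct of M) of the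
  --   β-contractions performed, in order.
  mutual
    data Eval : Term → List Ctx → Term → Set where
      e-var   : ∀ {x} → Eval (var x) [] (var x)
      e-lamId : ∀ {B} → la ≡ Id → Eval (lam B) [] (lam B)
      e-lamEv : ∀ {B cs B'} → la ≡ Ev → Eval B cs B' →
                Eval (lam B) (map lamC cs) (lam B')
      e-beta  : ∀ {M N B cs ds N' es V} →
                Eval M cs (lam B) →
                Arg ar₁ N ds N' →
                Eval (B [ N' ]) es V →
                Eval (app M N)
                     (map (λ C → appL C N) cs
                       ++ map (appR (lam B)) ds
                       ++ (□ ∷ es)) V
      -- op₁(M) = M' not an abstraction : op₂ = id, argument with ar₂
      e-app   : ∀ {M N M' cs ds N'} →
                Eval M cs M' → ¬ IsLam M' →
                Arg ar₂ N ds N' →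
                Eval (app M N)
                     (map (λ C → appL C N) cs ++ map (appR M') ds)
                     (app M' N')

    data Arg : Mode → Term → List Ctx → Term → Set where
      a-id : ∀ {N} → Arg Id N [] N
      a-ev : ∀ {N cs N'} → Eval N cs N' → Arg Ev N cs N'

  -- Prefix cs of the (possibly infinite) sequence of contractions
  -- performed by the evaluation of M (covers diverging evaluations).
  data Prefix : Term → List Ctx → Set where
    p-nil   : ∀ {M} → Prefix M []
    p-lam   : ∀ {B cs} → la ≡ Ev → Prefix B cs → Prefix (lam B) (map lamC cs)
    p-op    : ∀ {M N cs} → Prefix M cs →
              Prefix (app M N) (map (λ C → appL C N) cs)
    p-ar₁   : ∀ {M N B cs ds} →
              Eval M cs (lam B) → ar₁ ≡ Ev → Prefix N ds →
              Prefix (app M N)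
                     (map (λ C → appL C N) cs ++ map (appR (lam B)) ds)
    p-beta  : ∀ {M N B cs ds N' es} →
              Eval M cs (lam B) → Arg ar₁ N ds N' → Prefix (B [ N' ]) es →
              Prefix (app M N)
                     (map (λ C → appL C N) cs
                       ++ map (appR (lam B)) ds
                       ++ (□ ∷ es))
    p-ar₂   : ∀ {M N M' cs ds} →
              Eval M cs M' → ¬ IsLam M' → ar₂ ≡ Ev → Prefix N ds →
              Prefix (app M N)
                     (map (λ C → appL C N) cs ++ map (appR M') ds)

  -- ST_E : contexts C such that for some term C(R) the first redex
  -- contracted by E is the one at the hole of C.
  ST : Ctx → Set
  ST C = Σ Term (λ R → Prefix (plug C R) (C ∷ []))

-- Whether E, when it next contracts something inside C(R), descends through
-- a frame of C depends only on the frame itself: it descends under λ iff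
-- la = E, always into the operator, and into the argument of M N iff M is
-- returned unchanged by E without contractions and the parameter applied to
-- the argument (ar₁ if M is an abstraction, ar₂ otherwise) is E.  Hence ST_E
-- is the set of contexts all of whose frames are admissible in this local
-- sense (filling the hole with the redex (λx.x)x realises every such
-- context), and a frame-wise condition is preserved and reflected by
-- composition of contexts.
module Submission where

open import Defs
open import Data.List using ([]; _∷_)
open import Data.Product using (_×_; _,_)
open import Data.Product.Function.NonDependent.Propositional using (_×-⇔_)
open import Data.Sum using (_⊎_; inj₁; inj₂)
open import Data.Unit using (⊤; tt)
open import Function.Bundles using (_⇔_; mk⇔)
open import Function.Properties.Equivalence using (sym; trans)
open import Relation.Binary.PropositionalEquality using (_≡_; refl)
open import Relation.Nullary using (¬_)

module Uniformity (la ar₁ ar₂ : Mode) where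
  open EvalApply la ar₁ ar₂

  ArgumentNext : Term → Set
  ArgumentNext M = Eval M [] M × (IsLam M × ar₁ ≡ Ev ⊎ ¬ IsLam M × ar₂ ≡ Ev)

  Admissible : Ctx → Set
  Admissible □          = ⊤
  Admissible (lamC C)   = la ≡ Ev × Admissible C
  Admissible (appL C N) = Admissible C
  Admissible (appR M C) = ArgumentNext M × Admissible C

  Admissible-∘C : ∀ C₁ C₂ → Admissible (C₁ ∘C C₂) ⇔ (Admissible C₁ × Admissible C₂)
  Admissible-∘C C₁ C₂ = mk⇔ (split C₁) (λ (a₁ , a₂) → join C₁ a₁ a₂)
    where
    split : ∀ C → Admissible (C ∘C C₂) → Admissible C × Admissible C₂
    split □          a       = tt , a
    split (lamC C)   (x , a) = let (a₁ , a₂) = split C a in (x , a₁) , a₂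
    split (appL C N) a       = split C a
    split (appR M C) (w , a) = let (a₁ , a₂) = split C a in (w , a₁) , a₂

    join : ∀ C → Admissible C → Admissible C₂ → Admissible (C ∘C C₂)
    join □          _       a₂ = a₂
    join (lamC C)   (x , a) a₂ = x , join C a a₂
    join (appL C N) a       a₂ = join C a a₂
    join (appR M C) (w , a) a₂ = w , join C a a₂

  -- The list indices below are built from map and _++_, so equations such
  -- as cs ≡ [] are passed as arguments to let Agda split on the pieces.
  mutual
    contraction-free⇒≡ : ∀ {M cs V} → Eval M cs V → cs ≡ [] → V ≡ M
    contraction-free⇒≡ e-var       _ = refl
    contraction-free⇒≡ (e-lamId _) _ = refl
    contraction-free⇒≡ (e-lamEv {cs = []} _ e) _ with refl ← contraction-free⇒≡ e refl = refl
    contraction-free⇒≡ (e-beta {cs = []} {ds = []} _ _ _) ()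
    contraction-free⇒≡ (e-beta {cs = []} {ds = _ ∷ _} _ _ _) ()
    contraction-free⇒≡ (e-beta {cs = _ ∷ _} _ _ _) ()
    contraction-free⇒≡ (e-app {cs = []} {ds = []} e _ a) _
      with refl ← contraction-free⇒≡ e refl | refl ← contraction-free-arg⇒≡ a refl = refl

    contraction-free-arg⇒≡ : ∀ {m N ds N'} → Arg m N ds N' → ds ≡ [] → N' ≡ N
    contraction-free-arg⇒≡ a-id     _  = refl
    contraction-free-arg⇒≡ (a-ev e) eq = contraction-free⇒≡ e eq

  Eval-head-admissible : ∀ {M cs V C cs'} → Eval M cs V → cs ≡ C ∷ cs' → Admissible C
  Eval-head-admissible e-var ()
  Eval-head-admissible (e-lamId _) ()
  Eval-head-admissible (e-lamEv {cs = _ ∷ _} x e) refl = x , Eval-head-admissible e refl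
  Eval-head-admissible (e-beta {cs = _ ∷ _} e _ _) refl = Eval-head-admissible e refl
  Eval-head-admissible (e-beta {cs = []} {ds = []} _ _ _) refl = tt
  Eval-head-admissible (e-beta {cs = []} {ds = _ ∷ _} e (a-ev a) _) refl
    with refl ← contraction-free⇒≡ e refl =
    (e , inj₁ ((_ , refl) , refl)) , Eval-head-admissible a refl
  Eval-head-admissible (e-app {cs = _ ∷ _} e _ _) refl = Eval-head-admissible e refl
  Eval-head-admissible (e-app {cs = []} {ds = _ ∷ _} e ¬lam (a-ev a)) refl
    with refl ← contraction-free⇒≡ e refl =
    (e , inj₂ (¬lam , refl)) , Eval-head-admissible a refl

  Prefix-head-admissible : ∀ {M cs C cs'} → Prefix M cs → cs ≡ C ∷ cs' → Admissible C
  Prefix-head-admissible p-nil ()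
  Prefix-head-admissible (p-lam {cs = _ ∷ _} x p) refl = x , Prefix-head-admissible p refl
  Prefix-head-admissible (p-op {cs = _ ∷ _} p) refl = Prefix-head-admissible p refl
  Prefix-head-admissible (p-ar₁ {cs = _ ∷ _} e _ _) refl = Eval-head-admissible e refl
  Prefix-head-admissible (p-ar₁ {cs = []} {ds = _ ∷ _} e x p) refl
    with refl ← contraction-free⇒≡ e refl =
    (e , inj₁ ((_ , refl) , x)) , Prefix-head-admissible p refl
  Prefix-head-admissible (p-beta {cs = _ ∷ _} e _ _) refl = Eval-head-admissible e refl
  Prefix-head-admissible (p-beta {cs = []} {ds = []} _ _ _) refl = tt
  Prefix-head-admissible (p-beta {cs = []} {ds = _ ∷ _} e (a-ev a) _) refl
    with refl ← contraction-free⇒≡ e refl =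
    (e , inj₁ ((_ , refl) , refl)) , Eval-head-admissible a refl
  Prefix-head-admissible (p-ar₂ {cs = _ ∷ _} e _ _ _) refl = Eval-head-admissible e refl
  Prefix-head-admissible (p-ar₂ {cs = []} {ds = _ ∷ _} e ¬lam x p) refl
    with refl ← contraction-free⇒≡ e refl =
    (e , inj₂ (¬lam , x)) , Prefix-head-admissible p refl

  Eval-identity : Eval (lam (var 0)) [] (lam (var 0))
  Eval-identity = under la refl
    where
    under : ∀ m → la ≡ m → Eval (lam (var 0)) [] (lam (var 0))
    under Id la≡Id = e-lamId la≡Id
    under Ev la≡Ev = e-lamEv la≡Ev e-var

  Arg-var : ∀ m x → Arg m (var x) [] (var x)
  Arg-var Id _ = a-id
  Arg-var Ev _ = a-ev e-var

  Admissible⇒ST : ∀ C → Admissible C → ST C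
  Admissible⇒ST □ _ = app (lam (var 0)) (var 0) , p-beta Eval-identity (Arg-var ar₁ 0) p-nil
  Admissible⇒ST (lamC C) (x , a) =
    let (R , p) = Admissible⇒ST C a in R , p-lam x p
  Admissible⇒ST (appL C N) a =
    let (R , p) = Admissible⇒ST C a in R , p-op p
  Admissible⇒ST (appR M C) ((e , inj₁ ((_ , refl) , x)) , a) =
    let (R , p) = Admissible⇒ST C a in R , p-ar₁ e x p
  Admissible⇒ST (appR M C) ((e , inj₂ (¬lam , x)) , a) =
    let (R , p) = Admissible⇒ST C a in R , p-ar₂ e ¬lam x p

  ST⇔Admissible : ∀ C → ST C ⇔ Admissible C
  ST⇔Admissible C = mk⇔ (λ (_ , p) → Prefix-head-admissible p refl) (Admissible⇒ST C)

proposition7p5 : (la ar₁ ar₂ : Mode) → (C₁ C₂ : Ctx) →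
    EvalApply.ST la ar₁ ar₂ (C₁ ∘C C₂) ⇔
      (EvalApply.ST la ar₁ ar₂ C₁ × EvalApply.ST la ar₁ ar₂ C₂)
proposition7p5 la ar₁ ar₂ C₁ C₂ =
  trans (ST⇔Admissible (C₁ ∘C C₂))
    (trans (Admissible-∘C C₁ C₂)
      (sym (ST⇔Admissible C₁ ×-⇔ ST⇔Admissible C₂)))
  where open Uniformity la ar₁ ar₂
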